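{- For all integers $k \geq 1$ and $n \geq 0$, writing $\sigma_S(k,n) := \sum_{i=1}^{k} S_{n+i}$ for a sequence $(S_n)_{n\ge0}$, the following hold: (1) $\sigma_P(k,n) = \tfrac12(Q_{n+k+1}-Q_{n+1})$, and this equals $2P_{k/2}P_{k/2+n+1}$ if $k\equiv 0 \pmod 4$, and $Q_{k/2}Q_{k/2+n+1}$ if $k \equiv 2 \pmod 4$. (2) $\sigma_Q(k,n) = P_{n+k+1}-P_{n+1}$, and this equals $2P_{k/2}Q_{k/2+n+1}$ if $k\equiv 0 \pmod 4$, and $2Q_{k/2}P_{k/2+n+1}$ if $k \equiv 2 \pmod 4$. (3) $\sigma_B(k,n) = \tfrac14(P_{2k+2n+1}-P_{2n+1})$, and this equals $\tfrac12 P_kQ_{k+2n+1}$ if $k$ is even, and $\tfrac12 Q_kP_{k+2n+1}$ if $k$ is odd. (4) $\sigma_C(k,n) = \tfrac12(Q_{2k+2n+1}-Q_{2n+1})$, and this equals $2P_kP_{k+2n+1}$ if $k$ is even, and $Q_kQ_{k+2n+1}$ if $k$ is odd. (5) $\sigma_c(k,n) = \tfrac12(Q_{2k+2n}-Q_{2n})$, and this equals $2P_kP_{k+2n}$ if $k$ is even, and $Q_kQ_{k+2n}$ if $k$ is odd.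
   Context: Pell sequence: $P_0=0$, $P_1=1$, $P_n=2P_{n-1}+P_{n-2}$. Associated Pell sequence: $Q_0=1$, $Q_1=1$, $Q_n=2Q_{n-1}+Q_{n-2}$. Balancing sequence: $B_0=0$, $B_1=1$, $B_n=6B_{n-1}-B_{n-2}$. Lucas-balancing sequence: $C_0=1$, $C_1=3$, $C_n=6C_{n-1}-C_{n-2}$. Lucas-cobalancing sequence: $c_0=-1$, $c_1=1$, $c_n=6c_{n-1}-c_{n-2}$. All recurrences hold for $n\ge 2$. -}

module Defs where

open import Data.Nat using (ℕ; zero; suc)
open import Data.Integer using (ℤ; +_; -[1+_]; _+_; _*_; _-_)

P : ℕ → ℤ
P zero = + 0
P (suc zero) = + 1
P (suc (suc n)) = + 2 * P (suc n) + P n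

Q : ℕ → ℤ
Q zero = + 1
Q (suc zero) = + 1
Q (suc (suc n)) = + 2 * Q (suc n) + Q n

B : ℕ → ℤ
B zero = + 0
B (suc zero) = + 1
B (suc (suc n)) = + 6 * B (suc n) - B n

C : ℕ → ℤ
C zero = + 1
C (suc zero) = + 3
C (suc (suc n)) = + 6 * C (suc n) - C n

c : ℕ → ℤ
c zero = -[1+ 0 ]
c (suc zero) = + 1
c (suc (suc n)) = + 6 * c (suc n) - c n

σ : (ℕ → ℤ) → ℕ → ℕ → ℤ
σ S zero n = + 0
σ S (suc k) n = σ S k n + S (n Data.Nat.+ suc k)

-- Every sequence in sight is a Pell or associated Pell sequence in disguise: the even- and
-- odd-indexed subsequences of a solution of x(m+2) = 2x(m+1) + x(m) solve x(m+2) = 6x(m+1) - x(m),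
-- whence 2B(m) = P(2m), C(m) = Q(2m) and c(m+1) = Q(2m+1).  Since P(m+1) - P(m) = Q(m) and
-- Q(m+1) - Q(m) = 2P(m), all five sums telescope.  Applying the addition formulas
-- P(a+r) = P(a)Q(r) + Q(a)P(r) and Q(a+r) = Q(a)Q(r) + 2P(a)P(r) twice gives, with the Pell norm
-- N(r) = Q(r)² - 2P(r)² = (-1)^r,
--   Q(a+2r) = N(r)Q(a) + 4P(r)P(a+r) = 2Q(r)Q(a+r) - N(r)Q(a),
--   P(a+2r) = N(r)P(a) + 2P(r)Q(a+r) = 2Q(r)P(a+r) - N(r)P(a),
-- which turn the telescoped differences into the products, according to the parity of r.
module Submission where

open import Defs
open import Data.Nat using (ℕ; zero; suc; _≤_; _%_; _/_)
import Data.Nat as ℕ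
import Data.Nat.Properties as ℕ
open import Data.Nat.DivMod using (m≡m%n+[m/n]*n; m∣n⇒o%n%m≡o%m; m%[n*o]/o≡m/o%n; m*n%n≡0; m*n/n≡m)
open import Data.Nat.Divisibility using (divides)
open import Data.Integer using (ℤ; +_; -_; _+_; _*_; _-_; -1ℤ)
import Data.Integer.Properties as ℤ
open import Data.List using (_∷_; [])
open import Data.Product using (_×_; _,_; proj₁)
open import Function using (_∘_)
open import Relation.Binary.PropositionalEquality using (_≡_; refl; sym; trans; cong; cong₂; module ≡-Reasoning)
import Data.Nat.Tactic.RingSolver as ℕ-Solver
import Data.Integer.Tactic.RingSolver as ℤ-Solver

open ≡-Reasoning

-- A record rather than a Π-type, so that Agda can infer the sequence from a proof.
record Solves (step : ℤ → ℤ → ℤ) (x : ℕ → ℤ) : Set where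
  constructor solves
  field recurrence : ∀ m → x (suc (suc m)) ≡ step (x (suc m)) (x m)

solutions-unique : ∀ {step x y} → Solves step x → Solves step y →
  x 0 ≡ y 0 → x 1 ≡ y 1 → ∀ m → x m ≡ y m
solutions-unique {step} {x} {y} (solves sx) (solves sy) x₀≡y₀ x₁≡y₁ = proj₁ ∘ agree
  where
  agree : ∀ m → x m ≡ y m × x (suc m) ≡ y (suc m)
  agree zero = x₀≡y₀ , x₁≡y₁
  agree (suc m) with agree m
  ... | xₘ≡yₘ , xₘ₊₁≡yₘ₊₁ = xₘ₊₁≡yₘ₊₁ , trans (sx m) (trans (cong₂ step xₘ₊₁≡yₘ₊₁ xₘ≡yₘ) (sym (sy m)))

solutions-shift : ∀ {step x} a → Solves step x → Solves step (λ r → x (a ℕ.+ r))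
solutions-shift {step} {x} a (solves sx) = solves λ r → begin
  x (a ℕ.+ suc (suc r))                  ≡⟨ cong x (ℕ.+-suc a (suc r)) ⟩
  x (suc (a ℕ.+ suc r))                  ≡⟨ cong (λ i → x (suc i)) (ℕ.+-suc a r) ⟩
  x (suc (suc (a ℕ.+ r)))                ≡⟨ sx (a ℕ.+ r) ⟩
  step (x (suc (a ℕ.+ r))) (x (a ℕ.+ r)) ≡⟨ cong (λ i → step (x i) (x (a ℕ.+ r))) (ℕ.+-suc a r) ⟨
  step (x (a ℕ.+ suc r)) (x (a ℕ.+ r))   ∎

pellStep : ℤ → ℤ → ℤ
pellStep u v = + 2 * u + v

balancingStep : ℤ → ℤ → ℤ
balancingStep u v = + 6 * u - v

pell-+ : ∀ {x y} → Solves pellStep x → Solves pellStep y → Solves pellStep (λ m → x m + y m)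
pell-+ {x} {y} (solves sx) (solves sy) = solves λ m → begin
  x (suc (suc m)) + y (suc (suc m))                       ≡⟨ cong₂ _+_ (sx m) (sy m) ⟩
  pellStep (x (suc m)) (x m) + pellStep (y (suc m)) (y m) ≡⟨ regroup (x (suc m)) (x m) (y (suc m)) (y m) ⟩
  pellStep (x (suc m) + y (suc m)) (x m + y m)            ∎
  where
  regroup : ∀ a b c d → (+ 2 * a + b) + (+ 2 * c + d) ≡ + 2 * (a + c) + (b + d)
  regroup = ℤ-Solver.solve-∀

pell-* : ∀ {x} α → Solves pellStep x → Solves pellStep (λ m → α * x m)
pell-* {x} α (solves sx) = solves λ m → begin
  α * x (suc (suc m))                ≡⟨ cong (α *_) (sx m) ⟩
  α * pellStep (x (suc m)) (x m)     ≡⟨ distrib α (x (suc m)) (x m) ⟩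
  pellStep (α * x (suc m)) (α * x m) ∎
  where
  distrib : ∀ α a b → α * (+ 2 * a + b) ≡ + 2 * (α * a) + α * b
  distrib = ℤ-Solver.solve-∀

balancing-* : ∀ {x} α → Solves balancingStep x → Solves balancingStep (λ m → α * x m)
balancing-* {x} α (solves sx) = solves λ m → begin
  α * x (suc (suc m))                     ≡⟨ cong (α *_) (sx m) ⟩
  α * balancingStep (x (suc m)) (x m)     ≡⟨ distrib α (x (suc m)) (x m) ⟩
  balancingStep (α * x (suc m)) (α * x m) ∎
  where
  distrib : ∀ α a b → α * (+ 6 * a - b) ≡ + 6 * (α * a) - α * b
  distrib = ℤ-Solver.solve-∀

pell-gap : ∀ {x} → Solves pellStep x → ∀ t → x (suc (suc t)) - x t ≡ + 2 * x (suc t)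
pell-gap {x} (solves sx) t = trans (cong (_- x t) (sx t)) (cancel (x (suc t)) (x t))
  where
  cancel : ∀ a b → (+ 2 * a + b) - b ≡ + 2 * a
  cancel = ℤ-Solver.solve-∀

pell-skip : ∀ {x} → Solves pellStep x → ∀ t →
  x (suc (suc (suc (suc t)))) ≡ balancingStep (x (suc (suc t))) (x t)
pell-skip {x} (solves sx) t = eliminate (x t) (x (suc t)) (sx (suc (suc t))) (sx (suc t)) (sx t)
  where
  eliminate : ∀ x₀ x₁ {x₂ x₃ x₄} → x₄ ≡ + 2 * x₃ + x₂ → x₃ ≡ + 2 * x₂ + x₁ → x₂ ≡ + 2 * x₁ + x₀ →
    x₄ ≡ + 6 * x₂ - x₀
  eliminate x₀ x₁ refl refl refl = ℤ-Solver.solve (x₀ ∷ x₁ ∷ [])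

bisection : ∀ {x} o → Solves pellStep x → Solves balancingStep (λ m → x (o ℕ.+ 2 ℕ.* m))
bisection {x} o sx = solves λ m → begin
  x (o ℕ.+ 2 ℕ.* suc (suc m))               ≡⟨ cong x (two-more (suc m)) ⟩
  x (suc (suc (o ℕ.+ 2 ℕ.* suc m)))         ≡⟨ cong (λ i → x (suc (suc i))) (two-more m) ⟩
  x (suc (suc (suc (suc (o ℕ.+ 2 ℕ.* m))))) ≡⟨ pell-skip sx (o ℕ.+ 2 ℕ.* m) ⟩
  balancingStep (x (suc (suc (o ℕ.+ 2 ℕ.* m)))) (x (o ℕ.+ 2 ℕ.* m))
    ≡⟨ cong (λ i → balancingStep (x i) (x (o ℕ.+ 2 ℕ.* m))) (two-more m) ⟨
  balancingStep (x (o ℕ.+ 2 ℕ.* suc m)) (x (o ℕ.+ 2 ℕ.* m)) ∎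
  where
  two-more : ∀ m → o ℕ.+ 2 ℕ.* suc m ≡ suc (suc (o ℕ.+ 2 ℕ.* m))
  two-more m = ℕ-Solver.solve (o ∷ m ∷ [])

module _ {x} (sx : Solves pellStep x) (m : ℕ) where
  pell-even-gap : x (2 ℕ.* suc m) - x (2 ℕ.* m) ≡ + 2 * x (suc (2 ℕ.* m))
  pell-even-gap = trans (cong (λ i → x i - x (2 ℕ.* m)) (ℕ.*-suc 2 m)) (pell-gap sx (2 ℕ.* m))

  pell-odd-gap : x (2 ℕ.* suc m ℕ.+ 1) - x (2 ℕ.* m ℕ.+ 1) ≡ + 2 * x (2 ℕ.* suc m)
  pell-odd-gap = begin
    x (2 ℕ.* suc m ℕ.+ 1) - x t ≡⟨ cong (λ i → x i - x t) (two-more m) ⟩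
    x (suc (suc t)) - x t       ≡⟨ pell-gap sx t ⟩
    + 2 * x (suc t)             ≡⟨ cong (λ i → + 2 * x i) (one-more m) ⟨
    + 2 * x (2 ℕ.* suc m)       ∎
    where
    t = 2 ℕ.* m ℕ.+ 1
    one-more : ∀ m → 2 ℕ.* suc m ≡ suc (2 ℕ.* m ℕ.+ 1)
    one-more = ℕ-Solver.solve-∀
    two-more : ∀ m → 2 ℕ.* suc m ℕ.+ 1 ≡ suc (suc (2 ℕ.* m ℕ.+ 1))
    two-more = ℕ-Solver.solve-∀

P-solves : Solves pellStep P
P-solves = solves λ _ → refl

Q-solves : Solves pellStep Q
Q-solves = solves λ _ → refl

P-suc : ∀ m → P (suc m) ≡ P m + Q m
P-suc = solutions-unique (solves λ _ → refl) (pell-+ P-solves Q-solves) refl refl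

Q-suc : ∀ m → Q (suc m) ≡ Q m + + 2 * P m
Q-suc = solutions-unique (solves λ _ → refl) (pell-+ Q-solves (pell-* (+ 2) P-solves)) refl refl

P-suc-diff : ∀ m → P (suc m) - P m ≡ Q m
P-suc-diff m = trans (cong (_- P m) (P-suc m)) (cancel (P m) (Q m))
  where
  cancel : ∀ a b → (a + b) - a ≡ b
  cancel = ℤ-Solver.solve-∀

Q-suc-diff : ∀ m → Q (suc m) - Q m ≡ + 2 * P m
Q-suc-diff m = trans (cong (_- Q m) (Q-suc m)) (cancel (Q m) (+ 2 * P m))
  where
  cancel : ∀ a b → (a + b) - a ≡ b
  cancel = ℤ-Solver.solve-∀

P-+ : ∀ a r → P (a ℕ.+ r) ≡ P a * Q r + Q a * P r
P-+ a = solutions-unique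
  (solutions-shift a P-solves) (pell-+ (pell-* (P a) Q-solves) (pell-* (Q a) P-solves))
  (trans (cong P (ℕ.+-identityʳ a)) (initial₀ (P a) (Q a)))
  (trans (cong P (ℕ.+-comm a 1)) (trans (P-suc a) (initial₁ (P a) (Q a))))
  where
  initial₀ : ∀ p q → p ≡ p * + 1 + q * + 0
  initial₀ = ℤ-Solver.solve-∀
  initial₁ : ∀ p q → p + q ≡ p * + 1 + q * + 1
  initial₁ = ℤ-Solver.solve-∀

Q-+ : ∀ a r → Q (a ℕ.+ r) ≡ Q a * Q r + + 2 * P a * P r
Q-+ a = solutions-unique
  (solutions-shift a Q-solves) (pell-+ (pell-* (Q a) Q-solves) (pell-* (+ 2 * P a) P-solves))
  (trans (cong Q (ℕ.+-identityʳ a)) (initial₀ (P a) (Q a)))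
  (trans (cong Q (ℕ.+-comm a 1)) (trans (Q-suc a) (initial₁ (P a) (Q a))))
  where
  initial₀ : ∀ p q → q ≡ q * + 1 + + 2 * p * + 0
  initial₀ = ℤ-Solver.solve-∀
  initial₁ : ∀ p q → q + + 2 * p ≡ q * + 1 + + 2 * p * + 1
  initial₁ = ℤ-Solver.solve-∀

pellNorm : ℕ → ℤ
pellNorm r = Q r * Q r - + 2 * P r * P r

pellNorm-suc : ∀ r → pellNorm (suc r) ≡ - pellNorm r
pellNorm-suc r = begin
  Q (suc r) * Q (suc r) - + 2 * P (suc r) * P (suc r)
    ≡⟨ cong₂ (λ q p → q * q - + 2 * p * p) (Q-suc r) (P-suc r) ⟩
  (Q r + + 2 * P r) * (Q r + + 2 * P r) - + 2 * (P r + Q r) * (P r + Q r)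
    ≡⟨ flip-sign (P r) (Q r) ⟩
  - pellNorm r ∎
  where
  flip-sign : ∀ p q → (q + + 2 * p) * (q + + 2 * p) - + 2 * (p + q) * (p + q) ≡ - (q * q - + 2 * p * p)
  flip-sign = ℤ-Solver.solve-∀

-- The recursion closes because suc (suc r) % 2 and r % 2 are definitionally equal.
pellNorm-mod2 : ∀ r → pellNorm r ≡ pellNorm (r % 2)
pellNorm-mod2 zero = refl
pellNorm-mod2 (suc zero) = refl
pellNorm-mod2 (suc (suc r)) = begin
  pellNorm (suc (suc r)) ≡⟨ pellNorm-suc (suc r) ⟩
  - pellNorm (suc r)     ≡⟨ cong -_ (pellNorm-suc r) ⟩
  - - pellNorm r         ≡⟨ ℤ.neg-involutive (pellNorm r) ⟩
  pellNorm r             ≡⟨ pellNorm-mod2 r ⟩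
  pellNorm (r % 2)       ∎

pellNorm-even : ∀ r → r % 2 ≡ 0 → pellNorm r ≡ + 1
pellNorm-even r r%2≡0 = trans (pellNorm-mod2 r) (cong pellNorm r%2≡0)

pellNorm-odd : ∀ r → r % 2 ≡ 1 → pellNorm r ≡ -1ℤ
pellNorm-odd r r%2≡1 = trans (pellNorm-mod2 r) (cong pellNorm r%2≡1)

module _ (a r : ℕ) where
  private
    pa = P a
    qa = Q a
    pr = P r
    qr = Q r

  P-add-twice : P (a ℕ.+ r ℕ.+ r) ≡ pellNorm r * P a + + 2 * P r * Q (a ℕ.+ r)
  P-add-twice = begin
    P (a ℕ.+ r ℕ.+ r)                                         ≡⟨ P-+ (a ℕ.+ r) r ⟩
    P (a ℕ.+ r) * qr + Q (a ℕ.+ r) * pr                       ≡⟨ cong₂ (λ p q → p * qr + q * pr) (P-+ a r) (Q-+ a r) ⟩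
    (pa * qr + qa * pr) * qr + (qa * qr + + 2 * pa * pr) * pr ≡⟨ identity pa qa pr qr ⟩
    pellNorm r * pa + + 2 * pr * (qa * qr + + 2 * pa * pr)   ≡⟨ cong (λ q → pellNorm r * pa + + 2 * pr * q) (Q-+ a r) ⟨
    pellNorm r * pa + + 2 * pr * Q (a ℕ.+ r)                  ∎
    where
    identity : ∀ pa qa pr qr → (pa * qr + qa * pr) * qr + (qa * qr + + 2 * pa * pr) * pr
                             ≡ (qr * qr - + 2 * pr * pr) * pa + + 2 * pr * (qa * qr + + 2 * pa * pr)
    identity = ℤ-Solver.solve-∀

  P-add-twice′ : P (a ℕ.+ r ℕ.+ r) ≡ + 2 * Q r * P (a ℕ.+ r) - pellNorm r * P a
  P-add-twice′ = begin
    P (a ℕ.+ r ℕ.+ r)                                         ≡⟨ P-+ (a ℕ.+ r) r ⟩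
    P (a ℕ.+ r) * qr + Q (a ℕ.+ r) * pr                       ≡⟨ cong₂ (λ p q → p * qr + q * pr) (P-+ a r) (Q-+ a r) ⟩
    (pa * qr + qa * pr) * qr + (qa * qr + + 2 * pa * pr) * pr ≡⟨ identity pa qa pr qr ⟩
    + 2 * qr * (pa * qr + qa * pr) - pellNorm r * pa          ≡⟨ cong (λ p → + 2 * qr * p - pellNorm r * pa) (P-+ a r) ⟨
    + 2 * qr * P (a ℕ.+ r) - pellNorm r * pa                  ∎
    where
    identity : ∀ pa qa pr qr → (pa * qr + qa * pr) * qr + (qa * qr + + 2 * pa * pr) * pr
                             ≡ + 2 * qr * (pa * qr + qa * pr) - (qr * qr - + 2 * pr * pr) * pa
    identity = ℤ-Solver.solve-∀

  Q-add-twice : Q (a ℕ.+ r ℕ.+ r) ≡ pellNorm r * Q a + + 4 * P r * P (a ℕ.+ r)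
  Q-add-twice = begin
    Q (a ℕ.+ r ℕ.+ r)                                               ≡⟨ Q-+ (a ℕ.+ r) r ⟩
    Q (a ℕ.+ r) * qr + + 2 * P (a ℕ.+ r) * pr                       ≡⟨ cong₂ (λ q p → q * qr + + 2 * p * pr) (Q-+ a r) (P-+ a r) ⟩
    (qa * qr + + 2 * pa * pr) * qr + + 2 * (pa * qr + qa * pr) * pr ≡⟨ identity pa qa pr qr ⟩
    pellNorm r * qa + + 4 * pr * (pa * qr + qa * pr)                ≡⟨ cong (λ p → pellNorm r * qa + + 4 * pr * p) (P-+ a r) ⟨
    pellNorm r * qa + + 4 * pr * P (a ℕ.+ r)                        ∎
    where
    identity : ∀ pa qa pr qr → (qa * qr + + 2 * pa * pr) * qr + + 2 * (pa * qr + qa * pr) * pr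
                             ≡ (qr * qr - + 2 * pr * pr) * qa + + 4 * pr * (pa * qr + qa * pr)
    identity = ℤ-Solver.solve-∀

  Q-add-twice′ : Q (a ℕ.+ r ℕ.+ r) ≡ + 2 * Q r * Q (a ℕ.+ r) - pellNorm r * Q a
  Q-add-twice′ = begin
    Q (a ℕ.+ r ℕ.+ r)                                               ≡⟨ Q-+ (a ℕ.+ r) r ⟩
    Q (a ℕ.+ r) * qr + + 2 * P (a ℕ.+ r) * pr                       ≡⟨ cong₂ (λ q p → q * qr + + 2 * p * pr) (Q-+ a r) (P-+ a r) ⟩
    (qa * qr + + 2 * pa * pr) * qr + + 2 * (pa * qr + qa * pr) * pr ≡⟨ identity pa qa pr qr ⟩
    + 2 * qr * (qa * qr + + 2 * pa * pr) - pellNorm r * qa          ≡⟨ cong (λ q → + 2 * qr * q - pellNorm r * qa) (Q-+ a r) ⟨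
    + 2 * qr * Q (a ℕ.+ r) - pellNorm r * qa                        ∎
    where
    identity : ∀ pa qa pr qr → (qa * qr + + 2 * pa * pr) * qr + + 2 * (pa * qr + qa * pr) * pr
                             ≡ + 2 * qr * (qa * qr + + 2 * pa * pr) - (qr * qr - + 2 * pr * pr) * qa
    identity = ℤ-Solver.solve-∀

norm+1⇒gap : ∀ {x y z ε} → ε ≡ + 1 → x ≡ ε * y + z → x - y ≡ z
norm+1⇒gap {y = y} {z} refl refl = ℤ-Solver.solve (y ∷ z ∷ [])

norm-1⇒gap : ∀ {x y z ε} → ε ≡ -1ℤ → x ≡ z - ε * y → x - y ≡ z
norm-1⇒gap {y = y} {z} refl refl = ℤ-Solver.solve (y ∷ z ∷ [])

module _ (a r : ℕ) where
  P-gap-norm+1 : pellNorm r ≡ + 1 → P (a ℕ.+ r ℕ.+ r) - P a ≡ + 2 * P r * Q (a ℕ.+ r)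
  P-gap-norm+1 N≡1 = norm+1⇒gap N≡1 (P-add-twice a r)

  P-gap-norm-1 : pellNorm r ≡ -1ℤ → P (a ℕ.+ r ℕ.+ r) - P a ≡ + 2 * Q r * P (a ℕ.+ r)
  P-gap-norm-1 N≡-1 = norm-1⇒gap N≡-1 (P-add-twice′ a r)

  Q-gap-norm+1 : pellNorm r ≡ + 1 → Q (a ℕ.+ r ℕ.+ r) - Q a ≡ + 4 * P r * P (a ℕ.+ r)
  Q-gap-norm+1 N≡1 = norm+1⇒gap N≡1 (Q-add-twice a r)

  Q-gap-norm-1 : pellNorm r ≡ -1ℤ → Q (a ℕ.+ r ℕ.+ r) - Q a ≡ + 2 * Q r * Q (a ℕ.+ r)
  Q-gap-norm-1 N≡-1 = norm-1⇒gap N≡-1 (Q-add-twice′ a r)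

B-via-P : ∀ m → + 2 * B m ≡ P (2 ℕ.* m)
B-via-P = solutions-unique (balancing-* (+ 2) (solves λ _ → refl)) (bisection 0 P-solves) refl refl

C-via-Q : ∀ m → C m ≡ Q (2 ℕ.* m)
C-via-Q = solutions-unique (solves λ _ → refl) (bisection 0 Q-solves) refl refl

c-via-Q : ∀ m → c (suc m) ≡ Q (suc (2 ℕ.* m))
c-via-Q = solutions-unique (solves λ _ → refl) (bisection 1 Q-solves) refl refl

σ-telescope : ∀ {S} (F : ℕ → ℤ) α → (∀ m → α * S (suc m) ≡ F (suc m) - F m) →
  ∀ k n → α * σ S k n ≡ F (n ℕ.+ k) - F n
σ-telescope F α step zero n rewrite ℕ.+-identityʳ n =
  trans (ℤ.*-zeroʳ α) (sym (ℤ.+-inverseʳ (F n)))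
σ-telescope {S} F α step (suc k) n rewrite ℕ.+-suc n k = begin
  α * (σ S k n + S (suc (n ℕ.+ k)))                       ≡⟨ ℤ.*-distribˡ-+ α (σ S k n) _ ⟩
  α * σ S k n + α * S (suc (n ℕ.+ k))                     ≡⟨ cong₂ _+_ (σ-telescope F α step k n) (step (n ℕ.+ k)) ⟩
  (F (n ℕ.+ k) - F n) + (F (suc (n ℕ.+ k)) - F (n ℕ.+ k)) ≡⟨ collapse (F (n ℕ.+ k)) (F n) (F (suc (n ℕ.+ k))) ⟩
  F (suc (n ℕ.+ k)) - F n                                 ∎
  where
  collapse : ∀ a b c → (a - b) + (c - a) ≡ c - b
  collapse = ℤ-Solver.solve-∀

σP-closed : ∀ k n → + 2 * σ P k n ≡ Q (n ℕ.+ k ℕ.+ 1) - Q (n ℕ.+ 1)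
σP-closed = σ-telescope (λ m → Q (m ℕ.+ 1)) (+ 2) λ m →
  sym (trans (Q-suc-diff (m ℕ.+ 1)) (cong (λ i → + 2 * P i) (ℕ.+-comm m 1)))

σQ-closed : ∀ k n → σ Q k n ≡ P (n ℕ.+ k ℕ.+ 1) - P (n ℕ.+ 1)
σQ-closed k n = trans (sym (ℤ.*-identityˡ (σ Q k n))) (σ-telescope (λ m → P (m ℕ.+ 1)) (+ 1) step k n)
  where
  step : ∀ m → + 1 * Q (suc m) ≡ P (suc m ℕ.+ 1) - P (m ℕ.+ 1)
  step m = trans (ℤ.*-identityˡ _) (sym (trans (P-suc-diff (m ℕ.+ 1)) (cong Q (ℕ.+-comm m 1))))

module _ (k n : ℕ) where
  private
    doubled : 2 ℕ.* (n ℕ.+ k) ≡ 2 ℕ.* k ℕ.+ 2 ℕ.* n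
    doubled = ℕ-Solver.solve (k ∷ n ∷ [])

  σB-closed : + 4 * σ B k n ≡ P (2 ℕ.* k ℕ.+ 2 ℕ.* n ℕ.+ 1) - P (2 ℕ.* n ℕ.+ 1)
  σB-closed = trans (σ-telescope (λ m → P (2 ℕ.* m ℕ.+ 1)) (+ 4) step k n)
                    (cong (λ i → P (i ℕ.+ 1) - P (2 ℕ.* n ℕ.+ 1)) doubled)
    where
    step : ∀ m → + 4 * B (suc m) ≡ P (2 ℕ.* suc m ℕ.+ 1) - P (2 ℕ.* m ℕ.+ 1)
    step m = begin
      + 4 * B (suc m)                           ≡⟨ ℤ.*-assoc (+ 2) (+ 2) (B (suc m)) ⟩
      + 2 * (+ 2 * B (suc m))                   ≡⟨ cong (+ 2 *_) (B-via-P (suc m)) ⟩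
      + 2 * P (2 ℕ.* suc m)                     ≡⟨ pell-odd-gap P-solves m ⟨
      P (2 ℕ.* suc m ℕ.+ 1) - P (2 ℕ.* m ℕ.+ 1) ∎

  σC-closed : + 2 * σ C k n ≡ Q (2 ℕ.* k ℕ.+ 2 ℕ.* n ℕ.+ 1) - Q (2 ℕ.* n ℕ.+ 1)
  σC-closed = trans (σ-telescope (λ m → Q (2 ℕ.* m ℕ.+ 1)) (+ 2) step k n)
                    (cong (λ i → Q (i ℕ.+ 1) - Q (2 ℕ.* n ℕ.+ 1)) doubled)
    where
    step : ∀ m → + 2 * C (suc m) ≡ Q (2 ℕ.* suc m ℕ.+ 1) - Q (2 ℕ.* m ℕ.+ 1)
    step m = trans (cong (+ 2 *_) (C-via-Q (suc m))) (sym (pell-odd-gap Q-solves m))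

  σc-closed : + 2 * σ c k n ≡ Q (2 ℕ.* k ℕ.+ 2 ℕ.* n) - Q (2 ℕ.* n)
  σc-closed = trans (σ-telescope (λ m → Q (2 ℕ.* m)) (+ 2) step k n)
                    (cong (λ i → Q i - Q (2 ℕ.* n)) doubled)
    where
    step : ∀ m → + 2 * c (suc m) ≡ Q (2 ℕ.* suc m) - Q (2 ℕ.* m)
    step m = trans (cong (+ 2 *_) (c-via-Q m)) (sym (pell-even-gap Q-solves m))

2s≡4ab⇒s≡2ab : ∀ {s} a b → + 2 * s ≡ + 4 * a * b → s ≡ + 2 * a * b
2s≡4ab⇒s≡2ab {s} a b h = ℤ.*-cancelˡ-≡ (+ 2) s (+ 2 * a * b) (trans h (regroup a b))
  where
  regroup : ∀ a b → + 4 * a * b ≡ + 2 * (+ 2 * a * b)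
  regroup = ℤ-Solver.solve-∀

2s≡2ab⇒s≡ab : ∀ {s} a b → + 2 * s ≡ + 2 * a * b → s ≡ a * b
2s≡2ab⇒s≡ab {s} a b h = ℤ.*-cancelˡ-≡ (+ 2) s (a * b) (trans h (ℤ.*-assoc (+ 2) a b))

4s≡2ab⇒2s≡ab : ∀ {s} a b → + 4 * s ≡ + 2 * a * b → + 2 * s ≡ a * b
4s≡2ab⇒2s≡ab {s} a b h = ℤ.*-cancelˡ-≡ (+ 2) (+ 2 * s) (a * b)
  (trans (sym (ℤ.*-assoc (+ 2) (+ 2) s)) (trans h (ℤ.*-assoc (+ 2) a b)))

module _ {k : ℕ} (r n : ℕ) (k≡r+r : k ≡ r ℕ.+ r) where
  private
    gap-form : ∀ (x : ℕ → ℤ) → x (n ℕ.+ k ℕ.+ 1) - x (n ℕ.+ 1) ≡ x (n ℕ.+ 1 ℕ.+ r ℕ.+ r) - x (n ℕ.+ 1)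
    gap-form x = cong (λ i → x i - x (n ℕ.+ 1)) (trans (cong (λ k → n ℕ.+ k ℕ.+ 1) k≡r+r) (shift n r))
      where
      shift : ∀ n r → n ℕ.+ (r ℕ.+ r) ℕ.+ 1 ≡ n ℕ.+ 1 ℕ.+ r ℕ.+ r
      shift = ℕ-Solver.solve-∀
    swap : n ℕ.+ 1 ℕ.+ r ≡ r ℕ.+ n ℕ.+ 1
    swap = ℕ-Solver.solve (n ∷ r ∷ [])

  σP-norm+1 : pellNorm r ≡ + 1 → σ P k n ≡ + 2 * P r * P (r ℕ.+ n ℕ.+ 1)
  σP-norm+1 N≡1 = 2s≡4ab⇒s≡2ab (P r) (P (r ℕ.+ n ℕ.+ 1)) (begin
    + 2 * σ P k n                         ≡⟨ σP-closed k n ⟩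
    Q (n ℕ.+ k ℕ.+ 1) - Q (n ℕ.+ 1)       ≡⟨ gap-form Q ⟩
    Q (n ℕ.+ 1 ℕ.+ r ℕ.+ r) - Q (n ℕ.+ 1) ≡⟨ Q-gap-norm+1 (n ℕ.+ 1) r N≡1 ⟩
    + 4 * P r * P (n ℕ.+ 1 ℕ.+ r)         ≡⟨ cong (λ i → + 4 * P r * P i) swap ⟩
    + 4 * P r * P (r ℕ.+ n ℕ.+ 1)         ∎)

  σP-norm-1 : pellNorm r ≡ -1ℤ → σ P k n ≡ Q r * Q (r ℕ.+ n ℕ.+ 1)
  σP-norm-1 N≡-1 = 2s≡2ab⇒s≡ab (Q r) (Q (r ℕ.+ n ℕ.+ 1)) (begin
    + 2 * σ P k n                         ≡⟨ σP-closed k n ⟩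
    Q (n ℕ.+ k ℕ.+ 1) - Q (n ℕ.+ 1)       ≡⟨ gap-form Q ⟩
    Q (n ℕ.+ 1 ℕ.+ r ℕ.+ r) - Q (n ℕ.+ 1) ≡⟨ Q-gap-norm-1 (n ℕ.+ 1) r N≡-1 ⟩
    + 2 * Q r * Q (n ℕ.+ 1 ℕ.+ r)         ≡⟨ cong (λ i → + 2 * Q r * Q i) swap ⟩
    + 2 * Q r * Q (r ℕ.+ n ℕ.+ 1)         ∎)

  σQ-norm+1 : pellNorm r ≡ + 1 → σ Q k n ≡ + 2 * P r * Q (r ℕ.+ n ℕ.+ 1)
  σQ-norm+1 N≡1 = begin
    σ Q k n                               ≡⟨ σQ-closed k n ⟩
    P (n ℕ.+ k ℕ.+ 1) - P (n ℕ.+ 1)       ≡⟨ gap-form P ⟩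
    P (n ℕ.+ 1 ℕ.+ r ℕ.+ r) - P (n ℕ.+ 1) ≡⟨ P-gap-norm+1 (n ℕ.+ 1) r N≡1 ⟩
    + 2 * P r * Q (n ℕ.+ 1 ℕ.+ r)         ≡⟨ cong (λ i → + 2 * P r * Q i) swap ⟩
    + 2 * P r * Q (r ℕ.+ n ℕ.+ 1)         ∎

  σQ-norm-1 : pellNorm r ≡ -1ℤ → σ Q k n ≡ + 2 * Q r * P (r ℕ.+ n ℕ.+ 1)
  σQ-norm-1 N≡-1 = begin
    σ Q k n                               ≡⟨ σQ-closed k n ⟩
    P (n ℕ.+ k ℕ.+ 1) - P (n ℕ.+ 1)       ≡⟨ gap-form P ⟩
    P (n ℕ.+ 1 ℕ.+ r ℕ.+ r) - P (n ℕ.+ 1) ≡⟨ P-gap-norm-1 (n ℕ.+ 1) r N≡-1 ⟩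
    + 2 * Q r * P (n ℕ.+ 1 ℕ.+ r)         ≡⟨ cong (λ i → + 2 * Q r * P i) swap ⟩
    + 2 * Q r * P (r ℕ.+ n ℕ.+ 1)         ∎

module _ (k n : ℕ) where
  private
    odd-shift : 2 ℕ.* k ℕ.+ 2 ℕ.* n ℕ.+ 1 ≡ 2 ℕ.* n ℕ.+ 1 ℕ.+ k ℕ.+ k
    odd-shift = ℕ-Solver.solve (k ∷ n ∷ [])
    odd-swap : 2 ℕ.* n ℕ.+ 1 ℕ.+ k ≡ k ℕ.+ 2 ℕ.* n ℕ.+ 1
    odd-swap = ℕ-Solver.solve (k ∷ n ∷ [])
    even-shift : 2 ℕ.* k ℕ.+ 2 ℕ.* n ≡ 2 ℕ.* n ℕ.+ k ℕ.+ k
    even-shift = ℕ-Solver.solve (k ∷ n ∷ [])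
    even-swap : 2 ℕ.* n ℕ.+ k ≡ k ℕ.+ 2 ℕ.* n
    even-swap = ℕ.+-comm (2 ℕ.* n) k

  σB-norm+1 : pellNorm k ≡ + 1 → + 2 * σ B k n ≡ P k * Q (k ℕ.+ 2 ℕ.* n ℕ.+ 1)
  σB-norm+1 N≡1 = 4s≡2ab⇒2s≡ab (P k) (Q (k ℕ.+ 2 ℕ.* n ℕ.+ 1)) (begin
    + 4 * σ B k n                                      ≡⟨ σB-closed k n ⟩
    P (2 ℕ.* k ℕ.+ 2 ℕ.* n ℕ.+ 1) - P (2 ℕ.* n ℕ.+ 1) ≡⟨ cong (λ i → P i - P (2 ℕ.* n ℕ.+ 1)) odd-shift ⟩
    P (2 ℕ.* n ℕ.+ 1 ℕ.+ k ℕ.+ k) - P (2 ℕ.* n ℕ.+ 1) ≡⟨ P-gap-norm+1 (2 ℕ.* n ℕ.+ 1) k N≡1 ⟩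
    + 2 * P k * Q (2 ℕ.* n ℕ.+ 1 ℕ.+ k)               ≡⟨ cong (λ i → + 2 * P k * Q i) odd-swap ⟩
    + 2 * P k * Q (k ℕ.+ 2 ℕ.* n ℕ.+ 1)               ∎)

  σB-norm-1 : pellNorm k ≡ -1ℤ → + 2 * σ B k n ≡ Q k * P (k ℕ.+ 2 ℕ.* n ℕ.+ 1)
  σB-norm-1 N≡-1 = 4s≡2ab⇒2s≡ab (Q k) (P (k ℕ.+ 2 ℕ.* n ℕ.+ 1)) (begin
    + 4 * σ B k n                                      ≡⟨ σB-closed k n ⟩
    P (2 ℕ.* k ℕ.+ 2 ℕ.* n ℕ.+ 1) - P (2 ℕ.* n ℕ.+ 1) ≡⟨ cong (λ i → P i - P (2 ℕ.* n ℕ.+ 1)) odd-shift ⟩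
    P (2 ℕ.* n ℕ.+ 1 ℕ.+ k ℕ.+ k) - P (2 ℕ.* n ℕ.+ 1) ≡⟨ P-gap-norm-1 (2 ℕ.* n ℕ.+ 1) k N≡-1 ⟩
    + 2 * Q k * P (2 ℕ.* n ℕ.+ 1 ℕ.+ k)               ≡⟨ cong (λ i → + 2 * Q k * P i) odd-swap ⟩
    + 2 * Q k * P (k ℕ.+ 2 ℕ.* n ℕ.+ 1)               ∎)

  σC-norm+1 : pellNorm k ≡ + 1 → σ C k n ≡ + 2 * P k * P (k ℕ.+ 2 ℕ.* n ℕ.+ 1)
  σC-norm+1 N≡1 = 2s≡4ab⇒s≡2ab (P k) (P (k ℕ.+ 2 ℕ.* n ℕ.+ 1)) (begin
    + 2 * σ C k n                                      ≡⟨ σC-closed k n ⟩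
    Q (2 ℕ.* k ℕ.+ 2 ℕ.* n ℕ.+ 1) - Q (2 ℕ.* n ℕ.+ 1) ≡⟨ cong (λ i → Q i - Q (2 ℕ.* n ℕ.+ 1)) odd-shift ⟩
    Q (2 ℕ.* n ℕ.+ 1 ℕ.+ k ℕ.+ k) - Q (2 ℕ.* n ℕ.+ 1) ≡⟨ Q-gap-norm+1 (2 ℕ.* n ℕ.+ 1) k N≡1 ⟩
    + 4 * P k * P (2 ℕ.* n ℕ.+ 1 ℕ.+ k)               ≡⟨ cong (λ i → + 4 * P k * P i) odd-swap ⟩
    + 4 * P k * P (k ℕ.+ 2 ℕ.* n ℕ.+ 1)               ∎)

  σC-norm-1 : pellNorm k ≡ -1ℤ → σ C k n ≡ Q k * Q (k ℕ.+ 2 ℕ.* n ℕ.+ 1)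
  σC-norm-1 N≡-1 = 2s≡2ab⇒s≡ab (Q k) (Q (k ℕ.+ 2 ℕ.* n ℕ.+ 1)) (begin
    + 2 * σ C k n                                      ≡⟨ σC-closed k n ⟩
    Q (2 ℕ.* k ℕ.+ 2 ℕ.* n ℕ.+ 1) - Q (2 ℕ.* n ℕ.+ 1) ≡⟨ cong (λ i → Q i - Q (2 ℕ.* n ℕ.+ 1)) odd-shift ⟩
    Q (2 ℕ.* n ℕ.+ 1 ℕ.+ k ℕ.+ k) - Q (2 ℕ.* n ℕ.+ 1) ≡⟨ Q-gap-norm-1 (2 ℕ.* n ℕ.+ 1) k N≡-1 ⟩
    + 2 * Q k * Q (2 ℕ.* n ℕ.+ 1 ℕ.+ k)               ≡⟨ cong (λ i → + 2 * Q k * Q i) odd-swap ⟩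
    + 2 * Q k * Q (k ℕ.+ 2 ℕ.* n ℕ.+ 1)               ∎)

  σc-norm+1 : pellNorm k ≡ + 1 → σ c k n ≡ + 2 * P k * P (k ℕ.+ 2 ℕ.* n)
  σc-norm+1 N≡1 = 2s≡4ab⇒s≡2ab (P k) (P (k ℕ.+ 2 ℕ.* n)) (begin
    + 2 * σ c k n                         ≡⟨ σc-closed k n ⟩
    Q (2 ℕ.* k ℕ.+ 2 ℕ.* n) - Q (2 ℕ.* n) ≡⟨ cong (λ i → Q i - Q (2 ℕ.* n)) even-shift ⟩
    Q (2 ℕ.* n ℕ.+ k ℕ.+ k) - Q (2 ℕ.* n) ≡⟨ Q-gap-norm+1 (2 ℕ.* n) k N≡1 ⟩
    + 4 * P k * P (2 ℕ.* n ℕ.+ k)         ≡⟨ cong (λ i → + 4 * P k * P i) even-swap ⟩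
    + 4 * P k * P (k ℕ.+ 2 ℕ.* n)         ∎)

  σc-norm-1 : pellNorm k ≡ -1ℤ → σ c k n ≡ Q k * Q (k ℕ.+ 2 ℕ.* n)
  σc-norm-1 N≡-1 = 2s≡2ab⇒s≡ab (Q k) (Q (k ℕ.+ 2 ℕ.* n)) (begin
    + 2 * σ c k n                         ≡⟨ σc-closed k n ⟩
    Q (2 ℕ.* k ℕ.+ 2 ℕ.* n) - Q (2 ℕ.* n) ≡⟨ cong (λ i → Q i - Q (2 ℕ.* n)) even-shift ⟩
    Q (2 ℕ.* n ℕ.+ k ℕ.+ k) - Q (2 ℕ.* n) ≡⟨ Q-gap-norm-1 (2 ℕ.* n) k N≡-1 ⟩
    + 2 * Q k * Q (2 ℕ.* n ℕ.+ k)         ≡⟨ cong (λ i → + 2 * Q k * Q i) even-swap ⟩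
    + 2 * Q k * Q (k ℕ.+ 2 ℕ.* n)         ∎)

even⇒≡half+half : ∀ k → k % 2 ≡ 0 → k ≡ k / 2 ℕ.+ k / 2
even⇒≡half+half k k%2≡0 = begin
  k                     ≡⟨ m≡m%n+[m/n]*n k 2 ⟩
  k % 2 ℕ.+ k / 2 ℕ.* 2 ≡⟨ cong (ℕ._+ k / 2 ℕ.* 2) k%2≡0 ⟩
  k / 2 ℕ.* 2           ≡⟨ ℕ.*-comm (k / 2) 2 ⟩
  k / 2 ℕ.+ (k / 2 ℕ.+ 0) ≡⟨ cong (k / 2 ℕ.+_) (ℕ.+-identityʳ (k / 2)) ⟩
  k / 2 ℕ.+ k / 2       ∎

module _ (k s : ℕ) (k%4≡2s : k % 4 ≡ 2 ℕ.* s) where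
  %4≡2s⇒≡half+half : k ≡ k / 2 ℕ.+ k / 2
  %4≡2s⇒≡half+half = even⇒≡half+half k (begin
    k % 2       ≡⟨ m∣n⇒o%n%m≡o%m 2 4 k (divides 2 refl) ⟨
    k % 4 % 2   ≡⟨ cong (_% 2) (trans k%4≡2s (ℕ.*-comm 2 s)) ⟩
    s ℕ.* 2 % 2 ≡⟨ m*n%n≡0 s 2 ⟩
    0           ∎)

  %4≡2s⇒half%2≡s : k / 2 % 2 ≡ s
  %4≡2s⇒half%2≡s = begin
    k / 2 % 2   ≡⟨ m%[n*o]/o≡m/o%n k 2 2 ⟨
    k % 4 / 2   ≡⟨ cong (_/ 2) (trans k%4≡2s (ℕ.*-comm 2 s)) ⟩
    s ℕ.* 2 / 2 ≡⟨ m*n/n≡m s 2 ⟩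
    s           ∎

theorem14 : (k n : ℕ) → 1 ≤ k →
    ((+ 2 * σ P k n ≡ Q (n Data.Nat.+ k Data.Nat.+ 1) - Q (n Data.Nat.+ 1))
      × (k % 4 ≡ 0 → σ P k n ≡ + 2 * P (k / 2) * P (k / 2 Data.Nat.+ n Data.Nat.+ 1))
      × (k % 4 ≡ 2 → σ P k n ≡ Q (k / 2) * Q (k / 2 Data.Nat.+ n Data.Nat.+ 1)))
    × ((σ Q k n ≡ P (n Data.Nat.+ k Data.Nat.+ 1) - P (n Data.Nat.+ 1))
      × (k % 4 ≡ 0 → σ Q k n ≡ + 2 * P (k / 2) * Q (k / 2 Data.Nat.+ n Data.Nat.+ 1))
      × (k % 4 ≡ 2 → σ Q k n ≡ + 2 * Q (k / 2) * P (k / 2 Data.Nat.+ n Data.Nat.+ 1)))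
    × ((+ 4 * σ B k n ≡ P (2 Data.Nat.* k Data.Nat.+ 2 Data.Nat.* n Data.Nat.+ 1) - P (2 Data.Nat.* n Data.Nat.+ 1))
      × (k % 2 ≡ 0 → + 2 * σ B k n ≡ P k * Q (k Data.Nat.+ 2 Data.Nat.* n Data.Nat.+ 1))
      × (k % 2 ≡ 1 → + 2 * σ B k n ≡ Q k * P (k Data.Nat.+ 2 Data.Nat.* n Data.Nat.+ 1)))
    × ((+ 2 * σ C k n ≡ Q (2 Data.Nat.* k Data.Nat.+ 2 Data.Nat.* n Data.Nat.+ 1) - Q (2 Data.Nat.* n Data.Nat.+ 1))
      × (k % 2 ≡ 0 → σ C k n ≡ + 2 * P k * P (k Data.Nat.+ 2 Data.Nat.* n Data.Nat.+ 1))
      × (k % 2 ≡ 1 → σ C k n ≡ Q k * Q (k Data.Nat.+ 2 Data.Nat.* n Data.Nat.+ 1)))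
    × ((+ 2 * σ c k n ≡ Q (2 Data.Nat.* k Data.Nat.+ 2 Data.Nat.* n) - Q (2 Data.Nat.* n))
      × (k % 2 ≡ 0 → σ c k n ≡ + 2 * P k * P (k Data.Nat.+ 2 Data.Nat.* n))
      × (k % 2 ≡ 1 → σ c k n ≡ Q k * Q (k Data.Nat.+ 2 Data.Nat.* n)))
theorem14 k n _ =
    ( σP-closed k n
    , (λ h → σP-norm+1 (k / 2) n (%4≡2s⇒≡half+half k 0 h) (pellNorm-even (k / 2) (%4≡2s⇒half%2≡s k 0 h)))
    , (λ h → σP-norm-1 (k / 2) n (%4≡2s⇒≡half+half k 1 h) (pellNorm-odd (k / 2) (%4≡2s⇒half%2≡s k 1 h))))
  , ( σQ-closed k n
    , (λ h → σQ-norm+1 (k / 2) n (%4≡2s⇒≡half+half k 0 h) (pellNorm-even (k / 2) (%4≡2s⇒half%2≡s k 0 h)))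
    , (λ h → σQ-norm-1 (k / 2) n (%4≡2s⇒≡half+half k 1 h) (pellNorm-odd (k / 2) (%4≡2s⇒half%2≡s k 1 h))))
  , (σB-closed k n , σB-norm+1 k n ∘ pellNorm-even k , σB-norm-1 k n ∘ pellNorm-odd k)
  , (σC-closed k n , σC-norm+1 k n ∘ pellNorm-even k , σC-norm-1 k n ∘ pellNorm-odd k)
  , (σc-closed k n , σc-norm+1 k n ∘ pellNorm-even k , σc-norm-1 k n ∘ pellNorm-odd k)
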